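{- Let $G_{10,6}$ be the graph on $\{0,1\}^{10}$ where $u,v$ are adjacent iff their Hamming distance is $6$. Every $4$-clique of $G_{10,6}$ is equivalent under an isometry of $\{0,1\}^{10}$ to one of the two sets $K'_4=\{0_{10}, (1111110000), (1110001110), (0001111110)\}$ or $K''_4=\{0_{10}, (1111110000), (1110001110), (0101011011)\}$.
   Context: Isometries are those of $\{0,1\}^{10}$ with the Hamming metric (coordinate permutations composed with XOR-translations). -}

module Defs where

open import Data.Bool using (Bool; true; false; _xor_)
open import Data.Nat using (ℕ; zero; suc; _+_)
open import Data.Fin using (Fin)
open import Data.Vec using (Vec; []; _∷_; lookup; tabulate)
open import Data.List using (List; []; _∷_; map)
open import Data.List.Membership.Propositional using (_∈_)
open import Data.Fin.Permutation using (Permutation; _⟨$⟩ʳ_)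
open import Relation.Binary.PropositionalEquality using (_≡_)
open import Data.Product using (_×_)

Word : Set
Word = Vec Bool 10

hamming : ∀ {n} → Vec Bool n → Vec Bool n → ℕ
hamming []       []       = 0
hamming (x ∷ xs) (y ∷ ys) = (if-diff x y) + hamming xs ys
  where
  if-diff : Bool → Bool → ℕ
  if-diff a b with a xor b
  ... | true  = 1
  ... | false = 0

Adj : Word → Word → Set
Adj u v = hamming u v ≡ 6

-- a 4-clique of G_{10,6}, given by its four vertices (pairwise adjacent,
-- hence pairwise distinct)
IsClique4 : Word → Word → Word → Word → Set
IsClique4 a b c d =
  Adj a b × Adj a c × Adj a d × Adj b c × Adj b d × Adj c d

-- isometries of ({0,1}^10, Hamming): a coordinate permutation σ composed
-- with an XOR-translation by t:  x ↦ (i ↦ x (σ i) xor t i)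
applyIso : Permutation 10 10 → Word → Word → Word
applyIso σ t x = tabulate (λ i → lookup x (σ ⟨$⟩ʳ i) xor lookup t i)

_≐_ : List Word → List Word → Set
A ≐ B = (∀ {x} → x ∈ A → x ∈ B) × (∀ {x} → x ∈ B → x ∈ A)

data Equivalent (S T : List Word) : Set where
  equiv : (σ : Permutation 10 10) (t : Word) →
          map (applyIso σ t) S ≐ T → Equivalent S T

private
  O I : Bool
  O = false
  I = true

zero10 : Word
zero10 = O ∷ O ∷ O ∷ O ∷ O ∷ O ∷ O ∷ O ∷ O ∷ O ∷ []

w1111110000 w1110001110 w0001111110 w0101011011 : Word
w1111110000 = I ∷ I ∷ I ∷ I ∷ I ∷ I ∷ O ∷ O ∷ O ∷ O ∷ []
w1110001110 = I ∷ I ∷ I ∷ O ∷ O ∷ O ∷ I ∷ I ∷ I ∷ O ∷ []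
w0001111110 = O ∷ O ∷ O ∷ I ∷ I ∷ I ∷ I ∷ I ∷ I ∷ O ∷ []
w0101011011 = O ∷ I ∷ O ∷ I ∷ O ∷ I ∷ I ∷ O ∷ I ∷ I ∷ []

K4′ K4″ : List Word
K4′ = zero10 ∷ w1111110000 ∷ w1110001110 ∷ w0001111110 ∷ []
K4″ = zero10 ∷ w1111110000 ∷ w1110001110 ∷ w0101011011 ∷ []

module Submission where

-- Translating by a, the quadruple (a, b, c, d) is recorded coordinatewise by the column
-- (a ⊕ b, a ⊕ c, a ⊕ d) ∈ {0,1}³; two quadruples whose multisets of columns agree are
-- isometric (a coordinate permutation lines the columns up, a translation fixes the first
-- row). The length 10 and the six distances are linear in the eight column counts n_v, and
-- d(a,b) + d(a,c) = d(b,c) + 2 · #{columns where both b and c differ from a} forces each of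
-- the three pairwise overlaps to be 3. Everything is then determined by n₁₁₁ ∈ {0,1},
-- which gives K′₄ and K″₄ respectively.

open import Defs
open import Data.List using (List; []; _∷_; map; foldl; foldr; reverse; _++_; cartesianProduct)
open import Data.Sum using (_⊎_; inj₁; inj₂)
open import Data.Bool using (Bool; true; false; _∧_; _xor_; if_then_else_)
open import Data.Bool.Properties
  using (not-involutive; if-eta; xor-assoc; xor-comm; xor-same; xor-identityʳ; ∧-identityʳ; ∧-zeroʳ)
import Data.Bool.Properties as Bool
open import Data.Nat using (ℕ; zero; suc; _+_; _*_)
open import Data.Nat.Properties
  using (+-commutativeSemigroup; +-comm; +-identityʳ; +-cancelˡ-≡; *-cancelˡ-≡; 0≢1+n)
open import Data.Nat.ListAction using (sum)
open import Data.Nat.ListAction.Properties using (sum-↭)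
open import Algebra.Properties.CommutativeSemigroup +-commutativeSemigroup
  renaming (interchange to +-interchange)
open import Data.Nat.Tactic.RingSolver using (solve-∀)
open import Data.Fin using (Fin; zero; suc)
open import Data.Fin.Properties using (cast-is-id)
open import Data.Fin.Permutation using (Permutation; _⟨$⟩ʳ_)
open import Data.Vec as Vec using (Vec; lookup)
open import Data.Vec.Properties using (lookup∘tabulate; tabulate-cong; tabulate∘lookup)
import Data.List as List
open import Data.List.Properties using (map-cong; foldl-ʳ++; lookup-tabulate; ∷-injective)
open import Data.List.Membership.Propositional using (_∈_)
open import Data.List.Membership.Propositional.Properties using (∈-∃++; ∈-cartesianProduct⁺)
open import Data.List.Relation.Unary.Any using (here; there)
open import Data.List.Relation.Binary.Permutation.Propositional
  using (_↭_; ↭-refl; ↭-prep; ↭-sym; ↭-trans; ↭⇒↭ₛ)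
open import Data.List.Relation.Binary.Permutation.Propositional.Properties using (map⁺; shift)
open import Data.Product using (_×_; _,_; proj₁; proj₂)
open import Data.Product.Properties using (≡-dec)
import Data.Sum as Sum
open import Function using (_∘_)
open import Relation.Binary.Definitions using (DecidableEquality)
open import Relation.Binary.PropositionalEquality
open import Relation.Nullary using (does; yes; no; contradiction)
open import Relation.Nullary.Decidable using (dec-true)

xor-cancelˡ : ∀ x y z → (x xor y) xor (x xor z) ≡ y xor z
xor-cancelˡ false y     z = refl
xor-cancelˡ true  false z = not-involutive z
xor-cancelˡ true  true  z = refl

xor-transfer : ∀ x y x′ y′ → x xor y ≡ x′ xor y′ → y xor (x xor x′) ≡ y′
xor-transfer x y x′ y′ eq = begin
  y xor (x xor x′)    ≡⟨ xor-assoc y x x′ ⟨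
  (y xor x) xor x′    ≡⟨ cong (_xor x′) (trans (xor-comm y x) eq) ⟩
  (x′ xor y′) xor x′  ≡⟨ cong (_xor x′) (xor-comm x′ y′) ⟩
  (y′ xor x′) xor x′  ≡⟨ xor-assoc y′ x′ x′ ⟩
  y′ xor (x′ xor x′)  ≡⟨ cong (y′ xor_) (xor-same x′) ⟩
  y′ xor false        ≡⟨ xor-identityʳ y′ ⟩
  y′                  ∎
  where open ≡-Reasoning

sum-map-+ : ∀ {a} {A : Set a} (g h : A → ℕ) xs →
  sum (map (λ x → g x + h x) xs) ≡ sum (map g xs) + sum (map h xs)
sum-map-+ g h []       = refl
sum-map-+ g h (x ∷ xs) =
  trans (cong (g x + h x +_) (sum-map-+ g h xs)) (+-interchange (g x) (h x) _ _)

bit : Bool → ℕ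
bit false = 0
bit true  = 1

weight : ∀ {a} {A : Set a} → (A → Bool) → List A → ℕ
weight f xs = sum (map (bit ∘ f) xs)

weight-↭ : ∀ {a} {A : Set a} (f : A → Bool) {xs ys} → xs ↭ ys → weight f xs ≡ weight f ys
weight-↭ f p = sum-↭ (map⁺ (bit ∘ f) p)

if-bit : ∀ b c → (if b then bit c else 0) ≡ bit (c ∧ b)
if-bit true  c = cong bit (sym (∧-identityʳ c))
if-bit false c = cong bit (sym (∧-zeroʳ c))

if-+ : ∀ b m n → (if b then m + n else 0) ≡ (if b then m else 0) + (if b then n else 0)
if-+ true  m n = refl
if-+ false m n = refl

map-≡⇒≡-on : ∀ {a b} {A : Set a} {B : Set b} {f g : A → B} {xs x} →
  map f xs ≡ map g xs → x ∈ xs → f x ≡ g x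
map-≡⇒≡-on {xs = _ ∷ _} eq (here refl) = proj₁ (∷-injective eq)
map-≡⇒≡-on {xs = _ ∷ _} eq (there x∈) = map-≡⇒≡-on (proj₂ (∷-injective eq)) x∈

module Multiplicity {a} {A : Set a} (_≟_ : DecidableEquality A) where

  count : A → List A → ℕ
  count v = weight (λ x → does (x ≟ v))

  count-here : ∀ v xs → count v (v ∷ xs) ≡ suc (count v xs)
  count-here v xs = cong (λ b → bit b + count v xs) (dec-true (v ≟ v) refl)

  count≡suc⇒∈ : ∀ {v xs k} → count v xs ≡ suc k → v ∈ xs
  count≡suc⇒∈ {v} {x ∷ xs} h with x ≟ v
  ... | yes refl = here refl
  ... | no _     = there (count≡suc⇒∈ h)

  count-≗⇒↭ : ∀ xs ys → (∀ v → count v xs ≡ count v ys) → xs ↭ ys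
  count-≗⇒↭ []       []       _ = ↭-refl
  count-≗⇒↭ []       (y ∷ ys) h = contradiction (trans (h y) (count-here y ys)) 0≢1+n
  count-≗⇒↭ (x ∷ xs) ys       h
    with l , r , refl ← ∈-∃++ (count≡suc⇒∈ {x} {ys} (trans (sym (h x)) (count-here x xs)))
    = ↭-trans (↭-prep x (count-≗⇒↭ xs (l ++ r) tail-counts)) (↭-sym (shift x l r))
    where
    tail-counts : ∀ v → count v xs ≡ count v (l ++ r)
    tail-counts v = +-cancelˡ-≡ (bit (does (x ≟ v))) _ _
                      (trans (h v) (weight-↭ (λ y → does (y ≟ v)) (shift x l r)))

hamming-∷ : ∀ {n} x y (xs ys : Vec Bool n) →
  hamming (x Vec.∷ xs) (y Vec.∷ ys) ≡ bit (x xor y) + hamming xs ys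
hamming-∷ false false xs ys = refl
hamming-∷ false true  xs ys = refl
hamming-∷ true  false xs ys = refl
hamming-∷ true  true  xs ys = refl

hamming≡weight : ∀ {b n} {B : Set b} (f : B → Bool) (g : Fin n → B) (u v : Vec Bool n) →
  (∀ i → f (g i) ≡ lookup u i xor lookup v i) → hamming u v ≡ weight f (List.tabulate g)
hamming≡weight f g Vec.[]         Vec.[]         _ = refl
hamming≡weight f g (x Vec.∷ xs) (y Vec.∷ ys) h = begin
  hamming (x Vec.∷ xs) (y Vec.∷ ys)  ≡⟨ hamming-∷ x y xs ys ⟩
  bit (x xor y) + hamming xs ys      ≡⟨ cong₂ _+_ (cong bit (sym (h zero)))
                                                  (hamming≡weight f (g ∘ suc) xs ys (h ∘ suc)) ⟩
  weight f (List.tabulate g)         ∎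
  where open ≡-Reasoning

foldl-+-reverse : ∀ xs → foldl _+_ 0 (reverse xs) ≡ sum xs
foldl-+-reverse xs = trans (foldl-ʳ++ _+_ 0 xs {[]}) (flipped xs)
  where
  flipped : ∀ xs → foldr (λ x s → s + x) 0 xs ≡ sum xs
  flipped []       = refl
  flipped (x ∷ xs) = trans (+-comm _ x) (cong (x +_) (flipped xs))

overlap≡3 : ∀ {x y z} s → x ≡ 6 → y ≡ 6 → z ≡ 6 → x + y ≡ z + 2 * s → s ≡ 3
overlap≡3 s refl refl refl e = *-cancelˡ-≡ s 3 2 (sym (+-cancelˡ-≡ 6 6 (2 * s) e))

-- Once n₇ is fixed each equation, read left to right, has a single unknown and it comes
-- last, so splitting on n₇ lets unification solve the whole system.
triangular-system : ∀ {n₀ n₁ n₂ n₃ n₄ n₅ n₆ n₇} →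
  n₇ + n₆ ≡ 3 → n₇ + n₅ ≡ 3 → n₇ + n₃ ≡ 3 →
  n₇ + n₆ + n₅ + n₄ ≡ 6 → n₇ + n₆ + n₃ + n₂ ≡ 6 → n₇ + n₅ + n₃ + n₁ ≡ 6 →
  n₇ + n₆ + n₅ + n₄ + n₃ + n₂ + n₁ + n₀ ≡ 10 →
  n₀ ∷ n₁ ∷ n₂ ∷ n₃ ∷ n₄ ∷ n₅ ∷ n₆ ∷ n₇ ∷ [] ≡ 1 ∷ 0 ∷ 0 ∷ 3 ∷ 0 ∷ 3 ∷ 3 ∷ 0 ∷ [] ⊎
  n₀ ∷ n₁ ∷ n₂ ∷ n₃ ∷ n₄ ∷ n₅ ∷ n₆ ∷ n₇ ∷ [] ≡ 0 ∷ 1 ∷ 1 ∷ 2 ∷ 1 ∷ 2 ∷ 2 ∷ 1 ∷ []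
triangular-system {n₇ = 0}                         refl refl refl refl refl refl refl = inj₁ refl
triangular-system {n₇ = 1}                         refl refl refl refl refl refl refl = inj₂ refl
triangular-system {n₇ = 2}                         refl refl refl refl refl refl ()
triangular-system {n₇ = 3}                         refl refl refl refl refl refl ()
triangular-system {n₇ = suc (suc (suc (suc _)))} ()

-- nᵢ is the number of columns spelling i in binary (the order of allColumns below); the
-- hypotheses are the length and the distances d(a,b), d(a,c), d(a,d), d(b,c), d(b,d), d(c,d).
linear-system : ∀ {n₀ n₁ n₂ n₃ n₄ n₅ n₆ n₇} →
  sum (n₀ ∷ n₁ ∷ n₂ ∷ n₃ ∷ n₄ ∷ n₅ ∷ n₆ ∷ n₇ ∷ []) ≡ 10 →
  sum (n₄ ∷ n₅ ∷ n₆ ∷ n₇ ∷ []) ≡ 6 → sum (n₂ ∷ n₃ ∷ n₆ ∷ n₇ ∷ []) ≡ 6 →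
  sum (n₁ ∷ n₃ ∷ n₅ ∷ n₇ ∷ []) ≡ 6 → sum (n₂ ∷ n₃ ∷ n₄ ∷ n₅ ∷ []) ≡ 6 →
  sum (n₁ ∷ n₃ ∷ n₄ ∷ n₆ ∷ []) ≡ 6 → sum (n₁ ∷ n₂ ∷ n₅ ∷ n₆ ∷ []) ≡ 6 →
  n₀ ∷ n₁ ∷ n₂ ∷ n₃ ∷ n₄ ∷ n₅ ∷ n₆ ∷ n₇ ∷ [] ≡ 1 ∷ 0 ∷ 0 ∷ 3 ∷ 0 ∷ 3 ∷ 3 ∷ 0 ∷ [] ⊎
  n₀ ∷ n₁ ∷ n₂ ∷ n₃ ∷ n₄ ∷ n₅ ∷ n₆ ∷ n₇ ∷ [] ≡ 0 ∷ 1 ∷ 1 ∷ 2 ∷ 1 ∷ 2 ∷ 2 ∷ 1 ∷ []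
linear-system {n₀} {n₁} {n₂} {n₃} {n₄} {n₅} {n₆} {n₇} total ab ac ad bc bd cd =
  triangular-system
    (overlap≡3 (n₇ + n₆) ab′ ac′ bc′ (bc-overlap n₂ n₃ n₄ n₅ n₆ n₇))
    (overlap≡3 (n₇ + n₅) ab′ ad′ bd′ (bd-overlap n₁ n₃ n₄ n₅ n₆ n₇))
    (overlap≡3 (n₇ + n₃) ac′ ad′ cd′ (cd-overlap n₁ n₂ n₃ n₅ n₆ n₇))
    ab′ ac′ ad′ total′
  where
  backwards : ∀ xs {k} → sum xs ≡ k → foldl _+_ 0 (reverse xs) ≡ k
  backwards xs = trans (foldl-+-reverse xs)

  total′ : n₇ + n₆ + n₅ + n₄ + n₃ + n₂ + n₁ + n₀ ≡ 10
  total′ = backwards (n₀ ∷ n₁ ∷ n₂ ∷ n₃ ∷ n₄ ∷ n₅ ∷ n₆ ∷ n₇ ∷ []) total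
  ab′ : n₇ + n₆ + n₅ + n₄ ≡ 6
  ab′ = backwards (n₄ ∷ n₅ ∷ n₆ ∷ n₇ ∷ []) ab
  ac′ : n₇ + n₆ + n₃ + n₂ ≡ 6
  ac′ = backwards (n₂ ∷ n₃ ∷ n₆ ∷ n₇ ∷ []) ac
  ad′ : n₇ + n₅ + n₃ + n₁ ≡ 6
  ad′ = backwards (n₁ ∷ n₃ ∷ n₅ ∷ n₇ ∷ []) ad
  bc′ : n₅ + n₄ + n₃ + n₂ ≡ 6
  bc′ = backwards (n₂ ∷ n₃ ∷ n₄ ∷ n₅ ∷ []) bc
  bd′ : n₆ + n₄ + n₃ + n₁ ≡ 6
  bd′ = backwards (n₁ ∷ n₃ ∷ n₄ ∷ n₆ ∷ []) bd
  cd′ : n₆ + n₅ + n₂ + n₁ ≡ 6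
  cd′ = backwards (n₁ ∷ n₂ ∷ n₅ ∷ n₆ ∷ []) cd

  bc-overlap : ∀ n₂ n₃ n₄ n₅ n₆ n₇ →
    (n₇ + n₆ + n₅ + n₄) + (n₇ + n₆ + n₃ + n₂) ≡ (n₅ + n₄ + n₃ + n₂) + 2 * (n₇ + n₆)
  bc-overlap = solve-∀
  bd-overlap : ∀ n₁ n₃ n₄ n₅ n₆ n₇ →
    (n₇ + n₆ + n₅ + n₄) + (n₇ + n₅ + n₃ + n₁) ≡ (n₆ + n₄ + n₃ + n₁) + 2 * (n₇ + n₅)
  bd-overlap = solve-∀
  cd-overlap : ∀ n₁ n₂ n₃ n₅ n₆ n₇ →
    (n₇ + n₆ + n₃ + n₂) + (n₇ + n₅ + n₃ + n₁) ≡ (n₆ + n₅ + n₂ + n₁) + 2 * (n₇ + n₃)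
  cd-overlap = solve-∀

Column : Set
Column = Bool × Bool × Bool

_≟ᶜ_ : DecidableEquality Column
_≟ᶜ_ = ≡-dec Bool._≟_ (≡-dec Bool._≟_ Bool._≟_)

open Multiplicity _≟ᶜ_
open import Data.List.Relation.Binary.Permutation.Setoid (setoid Column)
  using (onIndices) renaming (_↭_ to _↭ₛ_)
open import Data.List.Relation.Binary.Permutation.Setoid.Properties (setoid Column)
  using (onIndices-lookup)

allBools : List Bool
allBools = false ∷ true ∷ []

allColumns : List Column
allColumns = cartesianProduct allBools (cartesianProduct allBools allBools)

∈-allColumns : ∀ v → v ∈ allColumns
∈-allColumns (x , y , z) =
  ∈-cartesianProduct⁺ (∈-allBools x) (∈-cartesianProduct⁺ (∈-allBools y) (∈-allBools z))
  where
  ∈-allBools : ∀ b → b ∈ allBools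
  ∈-allBools false = here refl
  ∈-allBools true  = there (here refl)

counts : List Column → List ℕ
counts xs = map (λ v → count v xs) allColumns

counts-≡⇒↭ : ∀ {xs ys} → counts xs ≡ counts ys → xs ↭ ys
counts-≡⇒↭ {xs} {ys} eq = count-≗⇒↭ xs ys λ v →
  map-≡⇒≡-on {f = λ v → count v xs} {g = λ v → count v ys} eq (∈-allColumns v)

ΣColumn : (Column → ℕ) → ℕ
ΣColumn g = sum (map g allColumns)

ΣColumn-cong : ∀ {g h : Column → ℕ} → (∀ v → g v ≡ h v) → ΣColumn g ≡ ΣColumn h
ΣColumn-cong g≗h = cong sum (map-cong g≗h allColumns)

ΣColumn-+ : ∀ g h → ΣColumn (λ v → g v + h v) ≡ ΣColumn g + ΣColumn h
ΣColumn-+ g h = sum-map-+ g h allColumns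

ΣColumn-indicator : ∀ (f : Column → Bool) x → ΣColumn (λ v → if f v then bit (does (x ≟ᶜ v)) else 0) ≡ bit (f x)
ΣColumn-indicator f x = trans (ΣColumn-cong (λ v → if-bit (f v) (does (x ≟ᶜ v)))) (evaluate x)
  where
  evaluate : ∀ x → ΣColumn (λ v → bit (does (x ≟ᶜ v) ∧ f v)) ≡ bit (f x)
  evaluate (false , false , false) = +-identityʳ _
  evaluate (false , false , true)  = +-identityʳ _
  evaluate (false , true  , false) = +-identityʳ _
  evaluate (false , true  , true)  = +-identityʳ _
  evaluate (true  , false , false) = +-identityʳ _
  evaluate (true  , false , true)  = +-identityʳ _
  evaluate (true  , true  , false) = +-identityʳ _
  evaluate (true  , true  , true)  = +-identityʳ _

weight≡ΣColumn : ∀ (f : Column → Bool) xs → weight f xs ≡ ΣColumn (λ v → if f v then count v xs else 0)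
weight≡ΣColumn f []       = sym (ΣColumn-cong {h = λ _ → 0} (λ v → if-eta (f v)))
weight≡ΣColumn f (x ∷ xs) = begin
  bit (f x) + weight f xs
    ≡⟨ cong₂ _+_ (sym (ΣColumn-indicator f x)) (weight≡ΣColumn f xs) ⟩
  ΣColumn fromHead + ΣColumn fromTail
    ≡⟨ ΣColumn-+ fromHead fromTail ⟨
  ΣColumn (λ v → fromHead v + fromTail v)
    ≡⟨ ΣColumn-cong (λ v → if-+ (f v) (bit (does (x ≟ᶜ v))) (count v xs)) ⟨
  ΣColumn (λ v → if f v then count v (x ∷ xs) else 0)
    ∎
  where
  open ≡-Reasoning
  fromHead fromTail : Column → ℕ
  fromHead v = if f v then bit (does (x ≟ᶜ v)) else 0
  fromTail v = if f v then count v xs else 0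

column : ∀ {n} (a b c d : Vec Bool n) → Fin n → Column
column a b c d i = (lookup a i xor lookup b i , lookup a i xor lookup c i , lookup a i xor lookup d i)

columns : ∀ {n} (a b c d : Vec Bool n) → List Column
columns a b c d = List.tabulate (column a b c d)

δab δac δad δbc δbd δcd : Column → Bool
δab (x , _ , _) = x
δac (_ , y , _) = y
δad (_ , _ , z) = z
δbc (x , y , _) = x xor y
δbd (x , _ , z) = x xor z
δcd (_ , y , z) = y xor z

-- The two count vectors are those of K′₄ and K″₄.
clique-column-counts : ∀ a b c d → IsClique4 a b c d →
  counts (columns a b c d) ≡ 1 ∷ 0 ∷ 0 ∷ 3 ∷ 0 ∷ 3 ∷ 3 ∷ 0 ∷ [] ⊎
  counts (columns a b c d) ≡ 0 ∷ 1 ∷ 1 ∷ 2 ∷ 1 ∷ 2 ∷ 2 ∷ 1 ∷ []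
clique-column-counts a b c d (ab , ac , ad , bc , bd , cd) =
  linear-system (as-ΣColumn (λ _ → true) refl)
    (distance δab a b (λ _ → refl) ab)
    (distance δac a c (λ _ → refl) ac)
    (distance δad a d (λ _ → refl) ad)
    (distance δbc b c (λ i → xor-cancelˡ (lookup a i) _ _) bc)
    (distance δbd b d (λ i → xor-cancelˡ (lookup a i) _ _) bd)
    (distance δcd c d (λ i → xor-cancelˡ (lookup a i) _ _) cd)
  where
  X : List Column
  X = columns a b c d

  as-ΣColumn : ∀ f {k} → weight f X ≡ k → ΣColumn (λ v → if f v then count v X else 0) ≡ k
  as-ΣColumn f = trans (sym (weight≡ΣColumn f X))

  distance : ∀ f u w → (∀ i → f (column a b c d i) ≡ lookup u i xor lookup w i) →
    hamming u w ≡ 6 → ΣColumn (λ v → if f v then count v X else 0) ≡ 6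
  distance f u w f≗ = as-ΣColumn f ∘ trans (sym (hamming≡weight f (column a b c d) u w f≗))

applyIso-≡ : ∀ σ t x y → (∀ i → lookup x (σ ⟨$⟩ʳ i) xor lookup t i ≡ lookup y i) → applyIso σ t x ≡ y
applyIso-≡ σ t x y h = trans (tabulate-cong h) (tabulate∘lookup y)

aligned-columns⇒equivalent : ∀ {a b c d a′ b′ c′ d′ : Word} (σ : Permutation 10 10) →
  (∀ i → column a′ b′ c′ d′ i ≡ column a b c d (σ ⟨$⟩ʳ i)) →
  Equivalent (a ∷ b ∷ c ∷ d ∷ []) (a′ ∷ b′ ∷ c′ ∷ d′ ∷ [])
aligned-columns⇒equivalent {a} {b} {c} {d} {a′} {b′} {c′} {d′} σ aligned =
  equiv σ t (subst (_≐ (a′ ∷ b′ ∷ c′ ∷ d′ ∷ [])) (sym images) ((λ m → m) , (λ m → m)))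
  where
  -- Chosen so that a goes to a′; every other row x then goes to x′, as columns record x ⊕ a.
  offset : Fin 10 → Bool
  offset i = lookup a (σ ⟨$⟩ʳ i) xor lookup a′ i

  t : Word
  t = Vec.tabulate offset

  moves : ∀ x x′ → (∀ i → lookup a (σ ⟨$⟩ʳ i) xor lookup x (σ ⟨$⟩ʳ i) ≡ lookup a′ i xor lookup x′ i) →
    applyIso σ t x ≡ x′
  moves x x′ h = applyIso-≡ σ t x x′ (λ i →
    trans (cong (lookup x (σ ⟨$⟩ʳ i) xor_) (lookup∘tabulate offset i))
          (xor-transfer (lookup a (σ ⟨$⟩ʳ i)) (lookup x (σ ⟨$⟩ʳ i)) (lookup a′ i) (lookup x′ i) (h i)))

  images : map (applyIso σ t) (a ∷ b ∷ c ∷ d ∷ []) ≡ a′ ∷ b′ ∷ c′ ∷ d′ ∷ []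
  images = cong₂ _∷_ (moves a a′ (λ i → trans (xor-same (lookup a (σ ⟨$⟩ʳ i))) (sym (xor-same (lookup a′ i)))))
          (cong₂ _∷_ (moves b b′ (λ i → sym (cong proj₁ (aligned i))))
          (cong₂ _∷_ (moves c c′ (λ i → sym (cong (proj₁ ∘ proj₂) (aligned i))))
          (cong₂ _∷_ (moves d d′ (λ i → sym (cong (proj₂ ∘ proj₂) (aligned i)))) refl)))

lookup-columns : ∀ (a b c d : Word) i → List.lookup (columns a b c d) i ≡ column a b c d i
lookup-columns a b c d i =
  trans (cong (List.lookup (columns a b c d)) (sym (cast-is-id refl i))) (lookup-tabulate (column a b c d) i)

counts-≡⇒equivalent : ∀ {a b c d a′ b′ c′ d′ : Word} →
  counts (columns a′ b′ c′ d′) ≡ counts (columns a b c d) →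
  Equivalent (a ∷ b ∷ c ∷ d ∷ []) (a′ ∷ b′ ∷ c′ ∷ d′ ∷ [])
counts-≡⇒equivalent {a} {b} {c} {d} {a′} {b′} {c′} {d′} eq = aligned-columns⇒equivalent σ aligned
  where
  p : columns a′ b′ c′ d′ ↭ₛ columns a b c d
  p = ↭⇒↭ₛ (counts-≡⇒↭ eq)

  σ : Permutation 10 10
  σ = onIndices p

  aligned : ∀ i → column a′ b′ c′ d′ i ≡ column a b c d (σ ⟨$⟩ʳ i)
  aligned i = begin
    column a′ b′ c′ d′ i                     ≡⟨ lookup-columns a′ b′ c′ d′ i ⟨
    List.lookup (columns a′ b′ c′ d′) i       ≡⟨ onIndices-lookup p i ⟩
    List.lookup (columns a b c d) (σ ⟨$⟩ʳ i)  ≡⟨ lookup-columns a b c d (σ ⟨$⟩ʳ i) ⟩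
    column a b c d (σ ⟨$⟩ʳ i)                ∎
    where open ≡-Reasoning

mainTheorem8 : (a b c d : Word) → IsClique4 a b c d →
    Equivalent (a ∷ b ∷ c ∷ d ∷ []) K4′ ⊎ Equivalent (a ∷ b ∷ c ∷ d ∷ []) K4″
mainTheorem8 a b c d clique =
  Sum.map (counts-≡⇒equivalent ∘ sym) (counts-≡⇒equivalent ∘ sym) (clique-column-counts a b c d clique)
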